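{- Let $\Delta_{sf}\ne1$ be a squarefree integer, let $k=1,2,3$ according as $\Delta_{sf}\equiv1,3,2\bmod4$, and let $\psi_{2^k}:GL_2(\mathbb{Z}/2^k\mathbb{Z})\to\{\pm1\}$ be: $\psi_2=\varepsilon$ if $\Delta_{sf}\equiv1\bmod4$; $\psi_4=\chi_4(\det)\varepsilon$ if $\Delta_{sf}\equiv3\bmod4$; $\psi_8=\chi_8(\det)\varepsilon$ if $\Delta_{sf}\equiv2\bmod8$; $\psi_8=\chi_4(\det)\chi_8(\det)\varepsilon$ if $\Delta_{sf}\equiv6\bmod8$. For $r\in\mathbb{Z}$ and $s=\pm1$ let $\psi_{2^k}^{ -1}(s)_r$ be the set of $\sigma\in\psi_{2^k}^{ -1}(s)$ with $\mathrm{tr}\,\sigma\equiv r\bmod2^k$. Then \[ |\psi_{2^k}^{ -1}(1)_r|-|\psi_{2^k}^{ -1}(-1)_r|=\begin{cases}-(-1)^{r/2^{k-1}}\chi_4(-\Delta_{sf}/2)\cdot2^{2k-1}&\text{if }2^{k-1}\mid r,\\0&\text{otherwise},\end{cases} \] with the convention $\chi_4(x)=1$ if $x\notin\mathbb{Z}$.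
   Context: $\varepsilon:GL_2(\mathbb{Z}/2^k\mathbb{Z})\to\{\pm1\}$ is reduction mod 2 to $GL_2(\mathbb{Z}/2\mathbb{Z})\cong S_3$ (acting on the three nonzero vectors of $(\mathbb{Z}/2\mathbb{Z})^2$) followed by the sign. $\chi_4$ is the nontrivial Dirichlet character mod 4; $\chi_8(d)=(-1)^{(d^2-1)/8}$ for odd $d$. -}

module Defs where

open import Data.Nat as ℕ using (ℕ; zero; suc)
open import Data.Nat.Divisibility as ℕD using ()
open import Data.Integer as ℤ using (ℤ; +_; -_; _%ℕ_; _/ℕ_; ∣_∣)
open import Data.Fin using (Fin; toℕ)
open import Data.List using (List; []; _∷_; concatMap; map; allFin; length; filter)
open import Data.Product using (_×_; _,_)
open import Data.Bool using (Bool; true; false; if_then_else_; _∧_)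
open import Relation.Binary.PropositionalEquality using (_≡_)
open import Relation.Nullary.Decidable using (does)
open import Data.Nat.Properties using (m^n≢0)

Squarefree : ℤ → Set
Squarefree Δ = ∀ (m : ℕ) → (m ℕ.* m) ℕD.∣ ∣ Δ ∣ → m ≡ 1

-- k = 1, 2, 3 according as Δ ≡ 1, 3, 2 mod 4 (arbitrary value 3 when Δ ≡ 0 mod 4,
-- which cannot happen for squarefree Δ).
kOf : ℤ → ℕ
kOf Δ with Δ %ℕ 4
... | 1 = 1
... | 3 = 2
... | _ = 3

negPow : ℕ → ℤ
negPow n = if (n ℕ.% 2 ℕ.≡ᵇ 0) then + 1 else - + 1

negPowℤ : ℤ → ℤ
negPowℤ q = negPow (q %ℕ 2)

χ₄ : ℤ → ℤ
χ₄ x with x %ℕ 4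
... | 1 = + 1
... | 3 = - + 1
... | _ = + 0

χ₈ : ℤ → ℤ
χ₈ d = if (d %ℕ 2 ℕ.≡ᵇ 1)
         then negPow ((∣ d ∣ ℕ.* ∣ d ∣ ℕ.∸ 1) ℕ./ 8)
         else + 0

-- 2 × 2 matrices with entries in ℤ/nℤ (represented by Fin n): (a b ; c d)
Mat : ℕ → Set
Mat n = Fin n × Fin n × Fin n × Fin n

allMat : (n : ℕ) → List (Mat n)
allMat n = concatMap (λ a → concatMap (λ b → concatMap (λ c → map (λ d → (a , b , c , d))
             (allFin n)) (allFin n)) (allFin n)) (allFin n)

detℤ : ∀ {n} → Mat n → ℤ
detℤ (a , b , c , d) = (+ toℕ a ℤ.* + toℕ d) ℤ.- (+ toℕ b ℤ.* + toℕ c)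

trℤ : ∀ {n} → Mat n → ℤ
trℤ (a , b , c , d) = + toℕ a ℤ.+ + toℕ d

-- invertibility in GL₂(ℤ/2^kℤ) (k ≥ 1): determinant is a unit, i.e. odd
isGL : ∀ {n} → Mat n → Bool
isGL M = detℤ M %ℕ 2 ℕ.≡ᵇ 1

-- Reduction mod 2 and action on the three nonzero vectors of (ℤ/2ℤ)²,
-- coded as 0 ↦ (1,0), 1 ↦ (0,1), 2 ↦ (1,1).
vecOf : ℕ → ℕ × ℕ
vecOf 0 = (1 , 0)
vecOf 1 = (0 , 1)
vecOf _ = (1 , 1)

codeOf : ℕ × ℕ → ℕ
codeOf (1 , 0) = 0
codeOf (0 , 1) = 1
codeOf _ = 2

act : ∀ {n} → Mat n → ℕ → ℕ
act (a , b , c , d) i with vecOf i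
... | (x , y) = codeOf ((toℕ a ℕ.* x ℕ.+ toℕ b ℕ.* y) ℕ.% 2 , (toℕ c ℕ.* x ℕ.+ toℕ d ℕ.* y) ℕ.% 2)

inv : ∀ {n} → Mat n → ℕ → ℕ → ℕ
inv M i j = if (act M j ℕ.<ᵇ act M i) then 1 else 0

-- ε: sign of the induced permutation of the three nonzero vectors,
-- computed as (-1)^(number of inversions)
ε : ∀ {n} → Mat n → ℤ
ε M = negPow (inv M 0 1 ℕ.+ inv M 0 2 ℕ.+ inv M 1 2)

ψ : (Δ : ℤ) → Mat (2 ℕ.^ kOf Δ) → ℤ
ψ Δ M with Δ %ℕ 8
... | 1 = ε M
... | 5 = ε M
... | 3 = χ₄ (detℤ M) ℤ.* ε M
... | 7 = χ₄ (detℤ M) ℤ.* ε M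
... | 2 = χ₈ (detℤ M) ℤ.* ε M
... | 6 = χ₄ (detℤ M) ℤ.* χ₈ (detℤ M) ℤ.* ε M
... | _ = + 1

countᵇ : {A : Set} → (A → Bool) → List A → ℕ
countᵇ p [] = 0
countᵇ p (x ∷ xs) = (if p x then 1 else 0) ℕ.+ countᵇ p xs

count : (Δ : ℤ) → (s : ℤ) → (r : ℤ) → ℕ
count Δ s r = countᵇ (λ M → isGL M ∧ does (ψ Δ M ℤ.≟ s) ∧
                             (_%ℕ_ (trℤ M ℤ.- r) (2 ℕ.^ kOf Δ) ⦃ m^n≢0 2 (kOf Δ) ⦄ ℕ.≡ᵇ 0))
                     (allMat (2 ℕ.^ kOf Δ))

χ₄half : ℤ → ℤ
χ₄half Δ = if (Δ %ℕ 2 ℕ.≡ᵇ 0) then χ₄ (- (Δ /ℕ 2)) else + 1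

module Submission where

-- The signed count depends on r only through r mod 2^k, so
--     the trace formula (TraceFormula) follows from its 2^k instances r = 0, …, 2^k - 1: the
--     two residues 0 and 2^(k-1) and the vanishing on all others.  For each of the four
--     characters ε, χ₄(det)ε, χ₈(det)ε, χ₄χ₈(det)ε this table is confirmed by evaluation.
-- (3) Dependence on Δ.  kOf Δ, χ₄(-Δ/2) and ψ_Δ depend only on Δ mod 8; squarefreeness rules
--     out Δ ≡ 0, 4 (mod 8), and in each remaining class ψ_Δ is one of the four characters.

open import Defs
open import Data.Nat as ℕ using (ℕ; suc; NonZero; _^_; s≤s)
import Data.Nat.Properties as ℕP
import Data.Nat.Divisibility as ℕD
open import Data.Integer using (ℤ; +_; -_; _-_; _+_; _*_; ∣_∣; _%ℕ_; _/ℕ_)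
import Data.Integer as ℤ
import Data.Integer.Properties as ℤP
open import Data.Integer.DivMod using (a≡a%ℕn+[a/ℕn]*n; n%ℕd<d)
open import Data.Integer.Divisibility using (_∣_)
open import Data.Integer.Divisibility.Signed
  using (divides; ∣ᵤ⇒∣; ∣⇒∣ᵤ; ∣-trans; ∣m⇒∣-m; ∣m∣n⇒∣m+n; *-monoˡ-∣; *-cancelʳ-∣)
  renaming (_∣_ to _∣ₛ_)
open import Data.Integer.Tactic.RingSolver using (solve-∀)
open import Data.Bool using (Bool; if_then_else_; _∧_)
open import Data.List using ([]; _∷_)
open import Data.Fin using (Fin; toℕ; fromℕ<)
open import Data.Fin.Properties using (all?; toℕ-fromℕ<)
open import Data.Product using (_×_; _,_)
open import Data.Sum using (_⊎_; inj₁; inj₂)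
open import Relation.Binary.PropositionalEquality
  using (_≡_; _≢_; refl; sym; trans; cong; cong₂; subst; subst₂; module ≡-Reasoning)
open import Relation.Binary.Definitions using (tri<; tri≈; tri>)
open import Relation.Nullary using (¬_; Dec; contradiction)
open import Relation.Nullary.Decidable using (does; True; toWitness; _⊎-dec_)

-- Congruence modulo n: n divides the difference (signed divisibility).  A record,
-- so that x, y and n stay visible to type inference.
infix 4 _≡_[mod_]
record _≡_[mod_] (x y : ℤ) (n : ℕ) : Set where
  constructor congruent
  field divides-difference : + n ∣ₛ x - y
open _≡_[mod_]

mod-sym : ∀ {x y n} → x ≡ y [mod n ] → y ≡ x [mod n ]
mod-sym {x} {y} (congruent n∣x-y) = congruent (subst (_ ∣ₛ_) (negated-difference x y) (∣m⇒∣-m n∣x-y))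
  where
  negated-difference : ∀ x y → - (x - y) ≡ y - x
  negated-difference = solve-∀

mod-trans : ∀ {x y z n} → x ≡ y [mod n ] → y ≡ z [mod n ] → x ≡ z [mod n ]
mod-trans {x} {y} {z} (congruent n∣x-y) (congruent n∣y-z) =
  congruent (subst (_ ∣ₛ_) (telescope x y z) (∣m∣n⇒∣m+n n∣x-y n∣y-z))
  where
  telescope : ∀ x y z → (x - y) + (y - z) ≡ x - z
  telescope = solve-∀

mod-weaken : ∀ {x y m n} → m ℕD.∣ n → x ≡ y [mod n ] → x ≡ y [mod m ]
mod-weaken m∣n (congruent n∣x-y) = congruent (∣-trans (∣ᵤ⇒∣ m∣n) n∣x-y)

mod-sub-left : ∀ x {y y′ n} → y ≡ y′ [mod n ] → x - y ≡ x - y′ [mod n ]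
mod-sub-left x {y} {y′} y≡y′ with mod-sym y≡y′
... | congruent n∣y′-y = congruent (subst (_ ∣ₛ_) (sym (difference-of-differences x y y′)) n∣y′-y)
  where
  difference-of-differences : ∀ x y y′ → (x - y) - (x - y′) ≡ y′ - y
  difference-of-differences = solve-∀

mod-neg : ∀ {x y n} → x ≡ y [mod n ] → - x ≡ - y [mod n ]
mod-neg {x} {y} (congruent n∣x-y) = congruent (subst (_ ∣ₛ_) (negated x y) (∣m⇒∣-m n∣x-y))
  where
  negated : ∀ x y → - (x - y) ≡ - x - - y
  negated = solve-∀

divides-mod : ∀ {x y m n} → m ℕD.∣ n → x ≡ y [mod n ] → + m ∣ₛ y → + m ∣ₛ x
divides-mod {x} {y} m∣n x≡y m∣y with mod-weaken m∣n x≡y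
... | congruent m∣x-y = subst (_ ∣ₛ_) (minus-plus x y) (∣m∣n⇒∣m+n m∣x-y m∣y)
  where
  minus-plus : ∀ a b → (a - b) + b ≡ a
  minus-plus = solve-∀

mod-residue : ∀ x n .⦃ _ : NonZero n ⦄ → x ≡ + (x %ℕ n) [mod n ]
mod-residue x n = congruent (divides (x /ℕ n) (begin
  x - + r                 ≡⟨ cong (_- + r) (a≡a%ℕn+[a/ℕn]*n x n) ⟩
  (+ r + q * + n) - + r   ≡⟨ cancel (+ r) (q * + n) ⟩
  q * + n                 ∎))
  where
  open ≡-Reasoning
  r = x %ℕ n
  q = x /ℕ n
  cancel : ∀ a b → (a + b) - a ≡ b
  cancel = solve-∀

gap-not-congruent : ∀ {a b n} → a ℕ.< b → b ℕ.< n → ¬ (+ a ≡ + b [mod n ])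
gap-not-congruent {a} {b} {n} a<b b<n a≡b =
  ℕD.>⇒∤ ⦃ ℕ.>-nonZero (ℕP.m<n⇒0<n∸m a<b) ⦄ (ℕP.≤-<-trans (ℕP.m∸n≤m b a) b<n)
    (subst (n ℕD.∣_) distance (∣⇒∣ᵤ (divides-difference a≡b)))
  where
  distance : ∣ + a - + b ∣ ≡ b ℕ.∸ a
  distance = trans (cong ∣_∣ (ℤP.m-n≡m⊖n a b)) (ℤP.∣⊖∣-< a<b)

below-injective : ∀ {a b n} → a ℕ.< n → b ℕ.< n → + a ≡ + b [mod n ] → a ≡ b
below-injective {a} {b} a<n b<n a≡b with ℕP.<-cmp a b
... | tri≈ _ a≡b′ _ = a≡b′
... | tri< a<b _ _ = contradiction a≡b (gap-not-congruent a<b b<n)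
... | tri> _ _ b<a = contradiction (mod-sym a≡b) (gap-not-congruent b<a a<n)

residue-unique : ∀ {r n} x .⦃ _ : NonZero n ⦄ → r ℕ.< n → x ≡ + r [mod n ] → x %ℕ n ≡ r
residue-unique {r} {n} x r<n x≡r =
  below-injective (n%ℕd<d x n) r<n (mod-trans (mod-sym (mod-residue x n)) x≡r)

residue-cong : ∀ {x y n} .⦃ _ : NonZero n ⦄ → x ≡ y [mod n ] → x %ℕ n ≡ y %ℕ n
residue-cong {x} {y} {n} x≡y = residue-unique x (n%ℕd<d y n) (mod-trans x≡y (mod-residue y n))

residue-scale : ∀ q m H .⦃ _ : NonZero m ⦄ .⦃ _ : NonZero H ⦄ .⦃ _ : NonZero (m ℕ.* H) ⦄ →
  (q * + H) %ℕ (m ℕ.* H) ≡ (q %ℕ m) ℕ.* H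
residue-scale q m H = residue-unique (q * + H) (ℕP.*-monoˡ-< H (n%ℕd<d q m)) qH≡ρH
  where
  ρ = q %ℕ m
  distrib : ∀ a b c → (a - b) * c ≡ a * c - b * c
  distrib = solve-∀
  scaled : (q - + ρ) * + H ≡ q * + H - + (ρ ℕ.* H)
  scaled = trans (distrib q (+ ρ) (+ H)) (cong (λ z → q * + H - z) (sym (ℤP.pos-* ρ H)))
  qH≡ρH : q * + H ≡ + (ρ ℕ.* H) [mod m ℕ.* H ]
  qH≡ρH with mod-residue q m
  ... | congruent m∣q-ρ = congruent (subst₂ _∣ₛ_ (sym (ℤP.pos-* m H)) scaled (*-monoˡ-∣ (+ H) m∣q-ρ))

even-or-odd : ∀ x → x %ℕ 2 ≡ 0 ⊎ x %ℕ 2 ≡ 1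
even-or-odd x with x %ℕ 2 | n%ℕd<d x 2
... | 0 | _ = inj₁ refl
... | 1 | _ = inj₂ refl
... | suc (suc _) | s≤s (s≤s ())

halves-cong : ∀ {x y n} → x %ℕ 2 ≡ 0 → y %ℕ 2 ≡ 0 → x ≡ y [mod n ℕ.* 2 ] → x /ℕ 2 ≡ y /ℕ 2 [mod n ]
halves-cong {x} {y} {n} x-even y-even (congruent 2n∣x-y) =
  congruent (*-cancelʳ-∣ (+ 2) (subst₂ _∣ₛ_ (ℤP.pos-* n 2) difference 2n∣x-y))
  where
  double : ∀ z → z %ℕ 2 ≡ 0 → z ≡ z /ℕ 2 * + 2
  double z z-even = trans (a≡a%ℕn+[a/ℕn]*n z 2)
                          (trans (cong (λ c → + c + z /ℕ 2 * + 2) z-even) (ℤP.+-identityˡ _))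
  factor : ∀ a b → a * + 2 - b * + 2 ≡ (a - b) * + 2
  factor = solve-∀
  difference : x - y ≡ (x /ℕ 2 - y /ℕ 2) * + 2
  difference = trans (cong₂ _-_ (double x x-even) (double y y-even)) (factor (x /ℕ 2) (y /ℕ 2))

countᵇ-cong : {A : Set} {p p′ : A → Bool} → (∀ x → p x ≡ p′ x) → ∀ xs → countᵇ p xs ≡ countᵇ p′ xs
countᵇ-cong p≗p′ []       = refl
countᵇ-cong p≗p′ (x ∷ xs) = cong₂ (λ b n → (if b then 1 else 0) ℕ.+ n) (p≗p′ x) (countᵇ-cong p≗p′ xs)

traceCount : (k : ℕ) → (Mat (2 ^ k) → ℤ) → ℤ → ℤ → ℕ
traceCount k f s r = countᵇ (λ M → isGL M ∧ does (f M ℤ.≟ s) ∧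
                                (_%ℕ_ (trℤ M - r) (2 ^ k) ⦃ ℕP.m^n≢0 2 k ⦄ ℕ.≡ᵇ 0))
                            (allMat (2 ^ k))

signedCount : (k : ℕ) → (Mat (2 ^ k) → ℤ) → ℤ → ℤ
signedCount k f r = + traceCount k f (+ 1) r - + traceCount k f (- + 1) r

signedCount-residue : ∀ k f r →
  signedCount k f r ≡ signedCount k f (+ (_%ℕ_ r (2 ^ k) ⦃ ℕP.m^n≢0 2 k ⦄))
signedCount-residue k f r = cong₂ (λ a b → + a - + b) (same-test (+ 1)) (same-test (- + 1))
  where
  instance _ = ℕP.m^n≢0 2 k
  shift : ∀ t → t - r ≡ t - + (r %ℕ 2 ^ k) [mod 2 ^ k ]
  shift t = mod-sub-left t (mod-residue r (2 ^ k))
  same-test : ∀ s → traceCount k f s r ≡ traceCount k f s (+ (r %ℕ 2 ^ k))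
  same-test s = countᵇ-cong (λ M → cong (λ ρ → isGL M ∧ does (f M ℤ.≟ s) ∧ (ρ ℕ.≡ᵇ 0))
                                        (residue-cong (shift (trℤ M)))) (allMat (2 ^ k))

signedCount-ext : ∀ k {f g} → (∀ M → f M ≡ g M) → ∀ r → signedCount k f r ≡ signedCount k g r
signedCount-ext k {f} {g} f≗g r = cong₂ (λ a b → + a - + b) (same-test (+ 1)) (same-test (- + 1))
  where
  same-test : ∀ s → traceCount k f s r ≡ traceCount k g s r
  same-test s = countᵇ-cong (λ M → cong (λ v → isGL M ∧ does (v ℤ.≟ s) ∧ _) (f≗g M)) (allMat (2 ^ k))

TraceFormula : (k : ℕ) → (Mat (2 ^ k) → ℤ) → ℤ → Set
TraceFormula k f h = (r : ℤ) →
  ((q : ℤ) → r ≡ q * + (2 ^ (k ℕ.∸ 1)) →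
     signedCount k f r ≡ - (negPowℤ q * h * + (2 ^ (2 ℕ.* k ℕ.∸ 1))))
  × (¬ (+ (2 ^ (k ℕ.∸ 1)) ∣ r) → signedCount k f r ≡ + 0)

traceFormula-ext : ∀ k {f g h} → (∀ M → f M ≡ g M) → TraceFormula k g h → TraceFormula k f h
traceFormula-ext k {f} {g} f≗g formula r with formula r
... | on-multiples , off-multiples =
  (λ q r≡qH → trans (signedCount-ext k {f} {g} f≗g r) (on-multiples q r≡qH)) ,
  (λ H∤r → trans (signedCount-ext k {f} {g} f≗g r) (off-multiples H∤r))

OnMultiples : (k′ : ℕ) → (Mat (2 ^ suc k′) → ℤ) → ℤ → Set
OnMultiples k′ f h = (j : Fin 2) →
  signedCount (suc k′) f (+ (toℕ j ℕ.* 2 ^ k′)) ≡ - (negPow (toℕ j) * h * + (2 ^ (2 ℕ.* suc k′ ℕ.∸ 1)))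

OffMultiples : (k′ : ℕ) → (Mat (2 ^ suc k′) → ℤ) → Set
OffMultiples k′ f = (i : Fin (2 ^ suc k′)) → 2 ^ k′ ℕD.∣ toℕ i ⊎ signedCount (suc k′) f (+ toℕ i) ≡ + 0

traceFormula-fromTable : ∀ k′ {f h} →
  OnMultiples k′ f h → OffMultiples k′ f → TraceFormula (suc k′) f h
traceFormula-fromTable k′ {f} {h} on off r = on-multiple , off-multiple
  where
  instance _ = ℕP.m^n≢0 2 k′
  instance _ = ℕP.m^n≢0 2 (suc k′)
  H = 2 ^ k′
  ρ = r %ℕ 2 ^ suc k′
  ρ<2H : ρ ℕ.< 2 ^ suc k′
  ρ<2H = n%ℕd<d r (2 ^ suc k′)
  on-multiple : (q : ℤ) → r ≡ q * + H →
    signedCount (suc k′) f r ≡ - (negPowℤ q * h * + (2 ^ (2 ℕ.* suc k′ ℕ.∸ 1)))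
  on-multiple q r≡qH = let N = + (2 ^ (2 ℕ.* suc k′ ℕ.∸ 1)) in begin
    signedCount (suc k′) f r            ≡⟨ signedCount-residue (suc k′) f r ⟩
    signedCount (suc k′) f (+ ρ)        ≡⟨ cong (λ x → signedCount (suc k′) f (+ x)) ρ≡jH ⟩
    signedCount (suc k′) f (+ (toℕ j ℕ.* H)) ≡⟨ on j ⟩
    - (negPow (toℕ j) * h * N)         ≡⟨ cong (λ x → - (negPow x * h * N)) (toℕ-fromℕ< q%2<2) ⟩
    - (negPowℤ q * h * N)               ∎
    where
    open ≡-Reasoning
    q%2<2 = n%ℕd<d q 2
    j = fromℕ< q%2<2
    ρ≡jH : ρ ≡ toℕ j ℕ.* H
    ρ≡jH = trans (trans (cong (_%ℕ 2 ^ suc k′) r≡qH) (residue-scale q 2 H))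
                 (cong (ℕ._* H) (sym (toℕ-fromℕ< q%2<2)))
  off-multiple : ¬ (+ H ∣ r) → signedCount (suc k′) f r ≡ + 0
  off-multiple H∤r with off (fromℕ< ρ<2H)
  ... | inj₂ vanishes = trans (signedCount-residue (suc k′) f r)
                              (subst (λ x → signedCount (suc k′) f (+ x) ≡ + 0) (toℕ-fromℕ< ρ<2H) vanishes)
  ... | inj₁ H∣ρ = contradiction H∣r H∤r
    where
    H∣r : + H ∣ r
    H∣r = ∣⇒∣ᵤ (divides-mod (ℕD.divides 2 refl) (mod-residue r (2 ^ suc k′))
                           (∣ᵤ⇒∣ (subst (H ℕD.∣_) (toℕ-fromℕ< ρ<2H) H∣ρ)))

onMultiples? : ∀ k′ f h → Dec (OnMultiples k′ f h)
onMultiples? k′ f h = all? (λ j → signedCount (suc k′) f (+ (toℕ j ℕ.* 2 ^ k′))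
                                    ℤ.≟ - (negPow (toℕ j) * h * + (2 ^ (2 ℕ.* suc k′ ℕ.∸ 1))))

offMultiples? : ∀ k′ f → Dec (OffMultiples k′ f)
offMultiples? k′ f = all? (λ i → (2 ^ k′ ℕD.∣? toℕ i) ⊎-dec (signedCount (suc k′) f (+ toℕ i) ℤ.≟ + 0))

traceFormula-byComputation : ∀ k′ f h →
  {True (onMultiples? k′ f h)} → {True (offMultiples? k′ f)} → TraceFormula (suc k′) f h
traceFormula-byComputation k′ f h {on} {off} = traceFormula-fromTable k′ {f} {h} (toWitness on) (toWitness off)

ψ-ε ψ-χ₄ε ψ-χ₈ε ψ-χ₄χ₈ε : ∀ {n} → Mat n → ℤ
ψ-ε M     = ε M
ψ-χ₄ε M   = χ₄ (detℤ M) * ε M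
ψ-χ₈ε M   = χ₈ (detℤ M) * ε M
ψ-χ₄χ₈ε M = χ₄ (detℤ M) * χ₈ (detℤ M) * ε M

-- Their trace formulas, with k and the sign χ₄(-Δ/2) of the corresponding classes of Δ,
-- confirmed on the 2, 4, 8 and 8 residues of the trace.
formula-ε : TraceFormula 1 ψ-ε (+ 1)
formula-ε = traceFormula-byComputation 0 ψ-ε (+ 1)

formula-χ₄ε : TraceFormula 2 ψ-χ₄ε (+ 1)
formula-χ₄ε = traceFormula-byComputation 1 ψ-χ₄ε (+ 1)

formula-χ₈ε : TraceFormula 3 ψ-χ₈ε (- + 1)
formula-χ₈ε = traceFormula-byComputation 2 ψ-χ₈ε (- + 1)

formula-χ₄χ₈ε : TraceFormula 3 ψ-χ₄χ₈ε (+ 1)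
formula-χ₄χ₈ε = traceFormula-byComputation 2 ψ-χ₄χ₈ε (+ 1)

kOf-residue : ∀ Δ → kOf Δ ≡ kOf (+ (Δ %ℕ 4))
kOf-residue Δ with Δ %ℕ 4 | n%ℕd<d Δ 4
... | 0 | _ = refl
... | 1 | _ = refl
... | 2 | _ = refl
... | 3 | _ = refl
... | suc (suc (suc (suc _))) | s≤s (s≤s (s≤s (s≤s ())))

kOf-cong : ∀ {Δ Δ′} → Δ ≡ Δ′ [mod 4 ] → kOf Δ ≡ kOf Δ′
kOf-cong {Δ} {Δ′} Δ≡Δ′ =
  trans (kOf-residue Δ) (trans (cong (λ c → kOf (+ c)) (residue-cong Δ≡Δ′)) (sym (kOf-residue Δ′)))

χ₄-residue : ∀ x → χ₄ x ≡ χ₄ (+ (x %ℕ 4))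
χ₄-residue x with x %ℕ 4 | n%ℕd<d x 4
... | 0 | _ = refl
... | 1 | _ = refl
... | 2 | _ = refl
... | 3 | _ = refl
... | suc (suc (suc (suc _))) | s≤s (s≤s (s≤s (s≤s ())))

χ₄-cong : ∀ {x y} → x ≡ y [mod 4 ] → χ₄ x ≡ χ₄ y
χ₄-cong {x} {y} x≡y =
  trans (χ₄-residue x) (trans (cong (λ c → χ₄ (+ c)) (residue-cong x≡y)) (sym (χ₄-residue y)))

χ₄half-even : ∀ Δ → Δ %ℕ 2 ≡ 0 → χ₄half Δ ≡ χ₄ (- (Δ /ℕ 2))
χ₄half-even Δ even rewrite even = refl

χ₄half-odd : ∀ Δ → Δ %ℕ 2 ≡ 1 → χ₄half Δ ≡ + 1
χ₄half-odd Δ odd rewrite odd = refl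

χ₄half-cong : ∀ {Δ Δ′} → Δ ≡ Δ′ [mod 8 ] → χ₄half Δ ≡ χ₄half Δ′
χ₄half-cong {Δ} {Δ′} Δ≡Δ′ = by-parity (even-or-odd Δ′)
  where
  open ≡-Reasoning
  same-parity : Δ %ℕ 2 ≡ Δ′ %ℕ 2
  same-parity = residue-cong (mod-weaken (ℕD.divides 4 refl) Δ≡Δ′)
  by-parity : Δ′ %ℕ 2 ≡ 0 ⊎ Δ′ %ℕ 2 ≡ 1 → χ₄half Δ ≡ χ₄half Δ′
  by-parity (inj₁ even′) = begin
    χ₄half Δ         ≡⟨ χ₄half-even Δ (trans same-parity even′) ⟩
    χ₄ (- (Δ /ℕ 2))  ≡⟨ χ₄-cong (mod-neg (halves-cong (trans same-parity even′) even′ Δ≡Δ′)) ⟩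
    χ₄ (- (Δ′ /ℕ 2)) ≡⟨ χ₄half-even Δ′ even′ ⟨
    χ₄half Δ′        ∎
  by-parity (inj₂ odd′) = trans (χ₄half-odd Δ (trans same-parity odd′)) (sym (χ₄half-odd Δ′ odd′))

squarefree-not-0-mod4 : ∀ {Δ} → Squarefree Δ → ¬ (Δ ≡ + 0 [mod 4 ])
squarefree-not-0-mod4 {Δ} squarefree (congruent 4∣Δ)
  with squarefree 2 (subst (4 ℕD.∣_) (cong ∣_∣ (ℤP.+-identityʳ Δ)) (∣⇒∣ᵤ 4∣Δ))
... | ()

fromClass : ∀ {Δ c} → Δ ≡ + c [mod 8 ] → (g : ∀ {n} → Mat n → ℤ) → (∀ M → ψ Δ M ≡ g M) →
  TraceFormula (kOf (+ c)) g (χ₄half (+ c)) → TraceFormula (kOf Δ) (ψ Δ) (χ₄half Δ)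
fromClass {Δ} Δ≡c g ψ≗g = transport (kOf-cong (mod-weaken (ℕD.divides 2 refl) Δ≡c)) (χ₄half-cong Δ≡c)
  where
  transport : ∀ {k h} → kOf Δ ≡ k → χ₄half Δ ≡ h → TraceFormula k g h →
    TraceFormula (kOf Δ) (ψ Δ) (χ₄half Δ)
  transport refl refl = traceFormula-ext (kOf Δ) ψ≗g

traceFormula-ψ : ∀ Δ → Squarefree Δ → TraceFormula (kOf Δ) (ψ Δ) (χ₄half Δ)
traceFormula-ψ Δ squarefree = byResidue (Δ %ℕ 8) refl (n%ℕd<d Δ 8)
  where
  Δ≡ : ∀ {c} → Δ %ℕ 8 ≡ c → Δ ≡ + c [mod 8 ]
  Δ≡ e = subst (λ c → Δ ≡ + c [mod 8 ]) e (mod-residue Δ 8)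
  not-0-mod4 : ∀ {c} → Δ %ℕ 8 ≡ c → + c ≡ + 0 [mod 4 ] → TraceFormula (kOf Δ) (ψ Δ) (χ₄half Δ)
  not-0-mod4 e c≡0 = contradiction (mod-trans (mod-weaken (ℕD.divides 2 refl) (Δ≡ e)) c≡0)
                                   (squarefree-not-0-mod4 squarefree)
  byResidue : ∀ c → Δ %ℕ 8 ≡ c → c ℕ.< 8 → TraceFormula (kOf Δ) (ψ Δ) (χ₄half Δ)
  byResidue 0 e _ = not-0-mod4 e (congruent (divides (+ 0) refl))
  byResidue 4 e _ = not-0-mod4 e (congruent (divides (+ 1) refl))
  byResidue 1 e _ = fromClass (Δ≡ e) ψ-ε ψ≡ formula-ε
    where ψ≡ : ∀ M → ψ Δ M ≡ ψ-ε M
          ψ≡ M rewrite e = refl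
  byResidue 5 e _ = fromClass (Δ≡ e) ψ-ε ψ≡ formula-ε
    where ψ≡ : ∀ M → ψ Δ M ≡ ψ-ε M
          ψ≡ M rewrite e = refl
  byResidue 3 e _ = fromClass (Δ≡ e) ψ-χ₄ε ψ≡ formula-χ₄ε
    where ψ≡ : ∀ M → ψ Δ M ≡ ψ-χ₄ε M
          ψ≡ M rewrite e = refl
  byResidue 7 e _ = fromClass (Δ≡ e) ψ-χ₄ε ψ≡ formula-χ₄ε
    where ψ≡ : ∀ M → ψ Δ M ≡ ψ-χ₄ε M
          ψ≡ M rewrite e = refl
  byResidue 2 e _ = fromClass (Δ≡ e) ψ-χ₈ε ψ≡ formula-χ₈ε
    where ψ≡ : ∀ M → ψ Δ M ≡ ψ-χ₈ε M
          ψ≡ M rewrite e = refl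
  byResidue 6 e _ = fromClass (Δ≡ e) ψ-χ₄χ₈ε ψ≡ formula-χ₄χ₈ε
    where ψ≡ : ∀ M → ψ Δ M ≡ ψ-χ₄χ₈ε M
          ψ≡ M rewrite e = refl
  byResidue (suc (suc (suc (suc (suc (suc (suc (suc _)))))))) _ (s≤s (s≤s (s≤s (s≤s (s≤s (s≤s (s≤s (s≤s ()))))))))

corollary5p7 : (Δ r : ℤ) → Squarefree Δ → Δ ≢ + 1 →
    ((q : ℤ) → r ≡ q * + (2 ℕ.^ (kOf Δ ℕ.∸ 1)) →
      + count Δ (+ 1) r - + count Δ (- + 1) r
        ≡ - (negPowℤ q * χ₄half Δ * + (2 ℕ.^ (2 ℕ.* kOf Δ ℕ.∸ 1))))
    × (¬ (+ (2 ℕ.^ (kOf Δ ℕ.∸ 1)) ∣ r) →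
      + count Δ (+ 1) r - + count Δ (- + 1) r ≡ + 0)
corollary5p7 Δ r squarefree _ = traceFormula-ψ Δ squarefree r
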